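{- For every prime $p>2$, \[Q(p,1)=-Q(1,p)=-\frac{1+\chi_4(p)}{\sqrt p}.\]
   Context: For $t\in\mathbb{Z}$ let $E_t:y^2=x^3+tx^2-(t+3)x+1$. For an odd prime $p$ and $t\bmod p$, $\lambda_t(p)=-p^{ -1/2}\sum_{x\bmod p}\big(\frac{x^3+tx^2-(t+3)x+1}{p}\big)$ (Legendre symbol), $\mu_t(p)=-\lambda_t(p)$, $\lambda_t(1)=\mu_t(1)=1$. $Q(p^{m_1},p^{m_2})=\frac1p\sum_{t\bmod p}\lambda_t(p^{m_1})\mu_t(p^{m_2})$. $\chi_4$ is the non-principal Dirichlet character modulo $4$. -}

module Defs where

open import Data.Nat as ℕ using (ℕ; zero; suc; NonZero; _≡ᵇ_)
open import Data.Integer as ℤ using (ℤ; +_; _%ℕ_)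
open import Data.Bool using (Bool; true; false; if_then_else_)
open import Data.List using (List; map; foldr; upTo)
open import Data.Bool.ListAction using (any)
open import Data.Rational as ℚ using (ℚ)

Σ< : ℕ → (ℕ → ℤ) → ℤ
Σ< n f = foldr ℤ._+_ ℤ.0ℤ (map f (upTo n))

legendre : (a : ℤ) (p : ℕ) → .{{NonZero p}} → ℤ
legendre a p with a %ℕ p
... | r = if r ≡ᵇ 0 then ℤ.0ℤ
          else (if any (λ y → ((y ℕ.* y) ℕ.% p) ≡ᵇ r) (upTo p) then ℤ.1ℤ else ℤ.-1ℤ)

cubic : ℤ → ℤ → ℤ
cubic t x = x ℤ.* x ℤ.* x ℤ.+ t ℤ.* x ℤ.* x ℤ.- (t ℤ.+ ℤ.+ 3) ℤ.* x ℤ.+ ℤ.1ℤ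

-- Character sum  S_t(p) = Σ_{x mod p} ( f_t(x) / p ).
-- The paper's λ_t(p) = - p^{-1/2} S_t(p).  We record the integer
-- A_t(p) := - S_t(p), so that  λ_t(p) = A_t(p) / √p  and  μ_t(p) = -A_t(p)/√p.
A : (t : ℕ) (p : ℕ) → .{{NonZero p}} → ℤ
A t p = ℤ.- Σ< p (λ x → legendre (cubic (+ t) (+ x)) p)

-- √p · Q(p,1) = √p · (1/p) Σ_{t mod p} λ_t(p) μ_t(1) = (1/p) Σ_t A_t(p)
sqrtp-Q-p-1 : (p : ℕ) → .{{NonZero p}} → ℚ
sqrtp-Q-p-1 p = Σ< p (λ t → A t p) ℚ./ p

-- √p · Q(1,p) = √p · (1/p) Σ_{t mod p} λ_t(1) μ_t(p) = (1/p) Σ_t (-A_t(p))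
sqrtp-Q-1-p : (p : ℕ) → .{{NonZero p}} → ℚ
sqrtp-Q-1-p p = Σ< p (λ t → ℤ.- A t p) ℚ./ p

χ₄ : ℕ → ℤ
χ₄ n with n ℕ.% 4
... | 1 = ℤ.1ℤ
... | 3 = ℤ.-1ℤ
... | _ = ℤ.0ℤ

-- f_t(x) = x³ − 3x + 1 + t(x² − x) is linear in t, so sum over t first.  For x ∉ {0, 1} the map
-- t ↦ f_t(x) permutes the residues mod p and the Legendre symbol sums to 0 over them; f_t(0) = 1
-- and f_t(1) = −1 contribute p and p·(−1/p).  Hence Σ_t A_t(p) = −p(1 + (−1/p)), and (−1/p) = χ₄(p):
-- the (p − 1)/2 nonzero squares are permuted by x ↦ x⁻¹, whose fixed points among them are 1 and,
-- exactly when −1 is a square, −1; so (p − 1)/2 ≡ 1 + [−1 is a square] (mod 2).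

module Submission where

open import Data.Nat as ℕ using (ℕ; NonZero; _<_)
open import Data.Nat.Primality using (Prime)

module FiniteSum where

  open import Defs using (Σ<)
  open import Data.Bool using (Bool; true; false; _∧_)
  open import Data.List using (map; foldr; applyUpTo)
  open import Data.Nat as ℕ using (ℕ; zero; suc; _<_; _≡ᵇ_; _<ᵇ_; z<s; s<s)
  import Data.Nat.Properties as ℕP
  open import Data.Integer as ℤ using (ℤ; +_; _+_; _*_; -_; 0ℤ; 1ℤ; _≤_)
  import Data.Integer.Properties as ℤP
  open import Algebra.Properties.AbelianGroup ℤP.+-0-abelianGroup using (∙-cancelˡ)
  open import Data.Integer.Tactic.RingSolver using (solve-∀)
  open import Data.Product using (∃; _×_; _,_)
  open import Data.Sum using (_⊎_; inj₁; inj₂; [_,_]′)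
  open import Data.Bool.Properties using (T-≡; ¬-not; ⇔→≡)
  open import Data.Empty using (⊥-elim)
  open import Function using (_∘_; id; _⇔_; mk⇔; Equivalence)
  open import Relation.Nullary using (¬_; yes; no)
  open import Relation.Binary.Definitions using (tri<; tri≈; tri>)
  open import Relation.Binary.PropositionalEquality

  ∑ : ℕ → (ℕ → ℤ) → ℤ
  ∑ zero    f = 0ℤ
  ∑ (suc n) f = f 0 + ∑ n (f ∘ suc)

  foldr-applyUpTo≡∑ : ∀ n (f : ℕ → ℤ) g → foldr _+_ 0ℤ (map f (applyUpTo g n)) ≡ ∑ n (f ∘ g)
  foldr-applyUpTo≡∑ zero    f g = refl
  foldr-applyUpTo≡∑ (suc n) f g = cong (_+_ (f (g 0))) (foldr-applyUpTo≡∑ n f (g ∘ suc))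

  Σ<≡∑ : ∀ n f → Σ< n f ≡ ∑ n f
  Σ<≡∑ n f = foldr-applyUpTo≡∑ n f id

  ∑-cong : ∀ n {f g : ℕ → ℤ} → (∀ x → x < n → f x ≡ g x) → ∑ n f ≡ ∑ n g
  ∑-cong zero    f≡g = refl
  ∑-cong (suc n) f≡g = cong₂ _+_ (f≡g 0 z<s) (∑-cong n (λ x x<n → f≡g (suc x) (s<s x<n)))

  ∑-distrib-+ : ∀ n (f g : ℕ → ℤ) → ∑ n (λ x → f x + g x) ≡ ∑ n f + ∑ n g
  ∑-distrib-+ zero    f g = refl
  ∑-distrib-+ (suc n) f g =
    trans (cong (_+_ (f 0 + g 0)) (∑-distrib-+ n (f ∘ suc) (g ∘ suc))) (interchange (f 0) (g 0) _ _)
    where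
    interchange : ∀ a b c d → (a + b) + (c + d) ≡ (a + c) + (b + d)
    interchange = solve-∀

  ∑-distribˡ-* : ∀ n c (f : ℕ → ℤ) → ∑ n (λ x → c * f x) ≡ c * ∑ n f
  ∑-distribˡ-* zero    c f = sym (ℤP.*-zeroʳ c)
  ∑-distribˡ-* (suc n) c f =
    trans (cong (_+_ (c * f 0)) (∑-distribˡ-* n c (f ∘ suc))) (sym (ℤP.*-distribˡ-+ c (f 0) _))

  ∑-distribʳ-* : ∀ n c (f : ℕ → ℤ) → ∑ n (λ x → f x * c) ≡ ∑ n f * c
  ∑-distribʳ-* n c f =
    trans (∑-cong n (λ x _ → ℤP.*-comm (f x) c)) (trans (∑-distribˡ-* n c f) (ℤP.*-comm c _))

  ∑-neg : ∀ n (f : ℕ → ℤ) → ∑ n (λ x → - f x) ≡ - ∑ n f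
  ∑-neg zero    f = refl
  ∑-neg (suc n) f = trans (cong (_+_ (- f 0)) (∑-neg n (f ∘ suc))) (sym (ℤP.neg-distrib-+ (f 0) _))

  Σ<-neg : ∀ n (f : ℕ → ℤ) → Σ< n (λ x → - f x) ≡ - Σ< n f
  Σ<-neg n f = trans (Σ<≡∑ n _) (trans (∑-neg n f) (cong -_ (sym (Σ<≡∑ n f))))

  ∑-const : ∀ n c → ∑ n (λ _ → c) ≡ + n * c
  ∑-const zero    c = refl
  ∑-const (suc n) c = begin
    c + ∑ n (λ _ → c)  ≡⟨ cong (_+_ c) (∑-const n c) ⟩
    c + + n * c        ≡⟨ cong (_+ + n * c) (ℤP.*-identityˡ c) ⟨
    1ℤ * c + + n * c   ≡⟨ ℤP.*-distribʳ-+ c 1ℤ (+ n) ⟨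
    + suc n * c        ∎
    where open ≡-Reasoning

  ∑-one : ∀ n → ∑ n (λ _ → 1ℤ) ≡ + n
  ∑-one zero    = refl
  ∑-one (suc n) = cong (_+_ 1ℤ) (∑-one n)

  ∑-zero : ∀ n (f : ℕ → ℤ) → (∀ x → x < n → f x ≡ 0ℤ) → ∑ n f ≡ 0ℤ
  ∑-zero n f f≡0 = trans (∑-cong n f≡0) (trans (∑-const n 0ℤ) (ℤP.*-zeroʳ (+ n)))

  ∑-comm : ∀ n m (f : ℕ → ℕ → ℤ) → ∑ n (λ x → ∑ m (f x)) ≡ ∑ m (λ y → ∑ n (λ x → f x y))
  ∑-comm zero    m f = sym (∑-zero m _ (λ _ _ → refl))
  ∑-comm (suc n) m f = trans (cong (_+_ (∑ m (f 0))) (∑-comm n m (f ∘ suc)))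
                             (sym (∑-distrib-+ m (f 0) (λ y → ∑ n (λ x → f (suc x) y))))

  ∑-supported-on-0-1 : ∀ n (f : ℕ → ℤ) → 2 ℕ.≤ n → (∀ x → 2 ℕ.≤ x → x < n → f x ≡ 0ℤ) →
    ∑ n f ≡ f 0 + f 1
  ∑-supported-on-0-1 (suc zero)    f (ℕ.s≤s ()) _
  ∑-supported-on-0-1 (suc (suc n)) f _ f≡0 =
    cong (_+_ (f 0)) (trans (cong (_+_ (f 1)) (∑-zero n _ λ x x<n → f≡0 (2 ℕ.+ x) (ℕP.m≤m+n 2 x) (s<s (s<s x<n))))
                            (ℤP.+-identityʳ (f 1)))

  ∑-≤ : ∀ n (f : ℕ → ℤ) → (∀ x → x < n → f x ≤ 1ℤ) → ∑ n f ≤ + n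
  ∑-≤ zero    f f≤1 = ℤP.≤-refl
  ∑-≤ (suc n) f f≤1 = ℤP.+-mono-≤ (f≤1 0 z<s) (∑-≤ n (f ∘ suc) (λ x x<n → f≤1 (suc x) (s<s x<n)))

  ∑≡n⇒≡1 : ∀ n (f : ℕ → ℤ) → (∀ x → x < n → f x ≤ 1ℤ) → ∑ n f ≡ + n → ∀ x → x < n → f x ≡ 1ℤ
  ∑≡n⇒≡1 (suc n) f f≤1 ∑f≡n x x<n = go x x<n
    where
    rest≤n : ∑ n (f ∘ suc) ≤ + n
    rest≤n = ∑-≤ n (f ∘ suc) (λ x x<n → f≤1 (suc x) (s<s x<n))
    f0≡1 : f 0 ≡ 1ℤ
    f0≡1 = ℤP.≤-antisym (f≤1 0 z<s)
             (ℤP.≮⇒≥ λ f0<1 → ℤP.<-irrefl ∑f≡n (ℤP.+-mono-<-≤ f0<1 rest≤n))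
    rest≡n : ∑ n (f ∘ suc) ≡ + n
    rest≡n = ∙-cancelˡ 1ℤ _ _ (trans (cong (_+ ∑ n (f ∘ suc)) (sym f0≡1)) ∑f≡n)
    go : ∀ x → x < suc n → f x ≡ 1ℤ
    go zero    _         = f0≡1
    go (suc x) (s<s x<n) = ∑≡n⇒≡1 n (f ∘ suc) (λ y y<n → f≤1 (suc y) (s<s y<n)) rest≡n x x<n

  𝟙 : Bool → ℤ
  𝟙 true  = 1ℤ
  𝟙 false = 0ℤ

  ≡ᵇ≡true⇒≡ : ∀ a b → (a ≡ᵇ b) ≡ true → a ≡ b
  ≡ᵇ≡true⇒≡ a b a≡ᵇb = ℕP.≡ᵇ⇒≡ a b (Equivalence.from T-≡ a≡ᵇb)

  ≡⇒≡ᵇ≡true : ∀ a b → a ≡ b → (a ≡ᵇ b) ≡ true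
  ≡⇒≡ᵇ≡true a b a≡b = Equivalence.to T-≡ (ℕP.≡⇒≡ᵇ a b a≡b)

  ≢⇒≡ᵇ≡false : ∀ a b → a ≢ b → (a ≡ᵇ b) ≡ false
  ≢⇒≡ᵇ≡false a b a≢b = ¬-not (a≢b ∘ ≡ᵇ≡true⇒≡ a b)

  ≡ᵇ-cong : ∀ a b c d → (a ≡ b ⇔ c ≡ d) → (a ≡ᵇ b) ≡ (c ≡ᵇ d)
  ≡ᵇ-cong a b c d a≡b⇔c≡d = ⇔→≡ (mk⇔
    (≡⇒≡ᵇ≡true c d ∘ Equivalence.to a≡b⇔c≡d ∘ ≡ᵇ≡true⇒≡ a b)
    (≡⇒≡ᵇ≡true a b ∘ Equivalence.from a≡b⇔c≡d ∘ ≡ᵇ≡true⇒≡ c d))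

  <⇒<ᵇ≡true : ∀ {a b} → a < b → (a <ᵇ b) ≡ true
  <⇒<ᵇ≡true a<b = Equivalence.to T-≡ (ℕP.<⇒<ᵇ a<b)

  ≮⇒<ᵇ≡false : ∀ a b → ¬ a < b → (a <ᵇ b) ≡ false
  ≮⇒<ᵇ≡false a b a≮b = ¬-not (a≮b ∘ ℕP.<ᵇ⇒< a b ∘ Equivalence.from T-≡)

  𝟙-two-points : ∀ {b y a₁ a₂} → a₁ ≢ a₂ → (b ≡ true ⇔ (y ≡ a₁ ⊎ y ≡ a₂)) →
    𝟙 b ≡ 𝟙 (y ≡ᵇ a₁) + 𝟙 (y ≡ᵇ a₂)
  𝟙-two-points {b} {y} {a₁} {a₂} a₁≢a₂ b⇔ with y ℕ.≟ a₁ | y ℕ.≟ a₂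
  ... | yes refl | yes refl = ⊥-elim (a₁≢a₂ refl)
  ... | yes y≡a₁ | no y≢a₂
    rewrite Equivalence.from b⇔ (inj₁ y≡a₁) | ≡⇒≡ᵇ≡true y a₁ y≡a₁ | ≢⇒≡ᵇ≡false y a₂ y≢a₂ = refl
  ... | no y≢a₁ | yes y≡a₂
    rewrite Equivalence.from b⇔ (inj₂ y≡a₂) | ≢⇒≡ᵇ≡false y a₁ y≢a₁ | ≡⇒≡ᵇ≡true y a₂ y≡a₂ = refl
  ... | no y≢a₁ | no y≢a₂
    rewrite ¬-not {b} (λ b≡true → [ y≢a₁ , y≢a₂ ]′ (Equivalence.to b⇔ b≡true))
          | ≢⇒≡ᵇ≡false y a₁ y≢a₁ | ≢⇒≡ᵇ≡false y a₂ y≢a₂ = refl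

  ∑-𝟙≡ᵇ-* : ∀ n c (h : ℕ → ℤ) → c < n → ∑ n (λ y → 𝟙 (y ≡ᵇ c) * h y) ≡ h c
  ∑-𝟙≡ᵇ-* (suc n) zero h _ =
    trans (cong₂ _+_ (ℤP.*-identityˡ (h 0)) (∑-zero n _ (λ _ _ → refl))) (ℤP.+-identityʳ (h 0))
  ∑-𝟙≡ᵇ-* (suc n) (suc c) h (s<s c<n) = trans (ℤP.+-identityˡ _) (∑-𝟙≡ᵇ-* n c (h ∘ suc) c<n)

  ∑-𝟙≡ᵇ : ∀ n c → c < n → ∑ n (λ y → 𝟙 (y ≡ᵇ c)) ≡ 1ℤ
  ∑-𝟙≡ᵇ n c c<n = trans (∑-cong n (λ y _ → sym (ℤP.*-identityʳ (𝟙 (y ≡ᵇ c))))) (∑-𝟙≡ᵇ-* n c (λ _ → 1ℤ) c<n)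

  ∑𝟙≡1⇒∃ : ∀ n (P : ℕ → Bool) → ∑ n (𝟙 ∘ P) ≡ 1ℤ → ∃ λ x → x < n × P x ≡ true
  ∑𝟙≡1⇒∃ (suc n) P ∑≡1 with P 0 in P0
  ... | true  = 0 , z<s , P0
  ... | false with x , x<n , Px ← ∑𝟙≡1⇒∃ n (P ∘ suc) (trans (sym (ℤP.+-identityˡ _)) ∑≡1)
                = suc x , s<s x<n , Px

  ∑𝟙≤1 : ∀ n (P : ℕ → Bool) → (∀ x y → x < n → y < n → P x ≡ true → P y ≡ true → x ≡ y) →
    ∑ n (𝟙 ∘ P) ≤ 1ℤ
  ∑𝟙≤1 zero    P unique = ℤP.<⇒≤ (ℤ.+<+ z<s)
  ∑𝟙≤1 (suc n) P unique with P 0 in P0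
  ... | true  = ℤP.≤-reflexive (cong (_+_ 1ℤ) (∑-zero n _ rest≡0))
    where
    rest≡0 : ∀ x → x < n → 𝟙 (P (suc x)) ≡ 0ℤ
    rest≡0 x x<n with P (suc x) in Px
    ... | true with () ← unique 0 (suc x) z<s (s<s x<n) P0 Px
    ... | false = refl
  ... | false = ℤP.≤-trans (ℤP.≤-reflexive (ℤP.+-identityˡ _))
     (∑𝟙≤1 n (P ∘ suc) λ x y x<n y<n Px Py →
        ℕP.suc-injective (unique (suc x) (suc y) (s<s x<n) (s<s y<n) Px Py))

  module Involution (n : ℕ) (σ : ℕ → ℕ) (σ-< : ∀ x → x < n → σ x < n)
                    (σ-involutive : ∀ x → x < n → σ (σ x) ≡ x) where

    ∑-reindex : ∀ (h : ℕ → ℤ) → ∑ n (h ∘ σ) ≡ ∑ n h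
    ∑-reindex h = begin
      ∑ n (h ∘ σ)                                   ≡⟨ ∑-cong n (λ x x<n → ∑-𝟙≡ᵇ-* n (σ x) h (σ-< x x<n)) ⟨
      ∑ n (λ x → ∑ n (λ y → 𝟙 (y ≡ᵇ σ x) * h y))   ≡⟨ ∑-comm n n _ ⟩
      ∑ n (λ y → ∑ n (λ x → 𝟙 (y ≡ᵇ σ x) * h y))   ≡⟨ ∑-cong n (λ y _ → ∑-distribʳ-* n (h y) _) ⟩
      ∑ n (λ y → ∑ n (λ x → 𝟙 (y ≡ᵇ σ x)) * h y)   ≡⟨ ∑-cong n (λ y y<n → cong (_* h y) (preimages y y<n)) ⟩
      ∑ n (λ y → 1ℤ * h y)                          ≡⟨ ∑-cong n (λ y _ → ℤP.*-identityˡ (h y)) ⟩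
      ∑ n h                                         ∎
      where
      open ≡-Reasoning
      preimages : ∀ y → y < n → ∑ n (λ x → 𝟙 (y ≡ᵇ σ x)) ≡ 1ℤ
      preimages y y<n = trans (∑-cong n (λ x x<n → cong 𝟙 (≡ᵇ-cong y (σ x) x (σ y) (mk⇔
                          (λ y≡σx → trans (sym (σ-involutive x x<n)) (cong σ (sym y≡σx)))
                          (λ x≡σy → trans (sym (σ-involutive y y<n)) (cong σ (sym x≡σy)))))))
                        (∑-𝟙≡ᵇ n (σ y) (σ-< y y<n))

    -- an orbit {x, σ x} of size two is counted once, at its larger element
    #pairs : (ℕ → Bool) → ℤ
    #pairs P = ∑ n (λ x → 𝟙 (P x ∧ (σ x <ᵇ x)))

    #fixed : (ℕ → Bool) → ℤ
    #fixed P = ∑ n (λ x → 𝟙 (P x ∧ (σ x ≡ᵇ x)))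

    ∑𝟙≡2#pairs+#fixed : ∀ (P : ℕ → Bool) → (∀ x → x < n → P (σ x) ≡ P x) →
      ∑ n (𝟙 ∘ P) ≡ (#pairs P + #pairs P) + #fixed P
    ∑𝟙≡2#pairs+#fixed P P∘σ≡P = begin
      ∑ n (𝟙 ∘ P)                             ≡⟨ ∑-cong n split ⟩
      ∑ n (λ x → (g x + g (σ x)) + k x)       ≡⟨ ∑-distrib-+ n _ k ⟩
      ∑ n (λ x → g x + g (σ x)) + #fixed P    ≡⟨ cong (_+ #fixed P) (∑-distrib-+ n g (g ∘ σ)) ⟩
      (#pairs P + ∑ n (g ∘ σ)) + #fixed P     ≡⟨ cong (λ z → (#pairs P + z) + #fixed P) (∑-reindex g) ⟩
      (#pairs P + #pairs P) + #fixed P        ∎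
      where
      open ≡-Reasoning
      g k : ℕ → ℤ
      g x = 𝟙 (P x ∧ (σ x <ᵇ x))
      k x = 𝟙 (P x ∧ (σ x ≡ᵇ x))
      split : ∀ x → x < n → 𝟙 (P x) ≡ (g x + g (σ x)) + k x
      split x x<n rewrite P∘σ≡P x x<n | σ-involutive x x<n with P x
      ... | false = refl
      ... | true with ℕP.<-cmp (σ x) x
      ... | tri< σx<x σx≢x x≮σx
        rewrite <⇒<ᵇ≡true σx<x | ≮⇒<ᵇ≡false x (σ x) x≮σx | ≢⇒≡ᵇ≡false (σ x) x σx≢x = refl
      ... | tri≈ σx≮x σx≡x x≮σx
        rewrite ≮⇒<ᵇ≡false (σ x) x σx≮x | ≮⇒<ᵇ≡false x (σ x) x≮σx | ≡⇒≡ᵇ≡true (σ x) x σx≡x = refl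
      ... | tri> σx≮x σx≢x x<σx
        rewrite ≮⇒<ᵇ≡false (σ x) x σx≮x | <⇒<ᵇ≡true x<σx | ≢⇒≡ᵇ≡false (σ x) x σx≢x = refl

module Congruence (n : ℕ) .{{_ : NonZero n}} where

  open import Data.Nat as ℕ using (ℕ; _<_; _≤_)
  import Data.Nat.Properties as ℕP
  import Data.Nat.Divisibility as ℕ∣
  import Data.Nat.DivMod as ℕD
  open import Data.Nat.Primality using (Prime; euclidsLemma)
  open import Data.Integer as ℤ using (ℤ; +_; _+_; _*_; -_; _-_; 0ℤ; _%ℕ_; _/ℕ_; ∣_∣)
  import Data.Integer.Properties as ℤP
  import Data.Integer.DivMod as ℤD
  open import Data.Integer.Divisibility.Signed
    using (_∣_; divides; ∣-refl; ∣m∣n⇒∣m+n; ∣m⇒∣-m; ∣m⇒∣m*n; ∣n⇒∣m*n; ∣⇒∣ᵤ; ∣ᵤ⇒∣)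
  open import Data.Integer.Tactic.RingSolver using (solve-∀)
  open import Data.Sum using (_⊎_; map)
  open import Relation.Binary.PropositionalEquality

  infix 4 _≋_
  record _≋_ (a b : ℤ) : Set where
    constructor ∣⇒≋
    field ≋⇒∣ : + n ∣ a - b

  ≋-refl : ∀ {a} → a ≋ a
  ≋-refl {a} = ∣⇒≋ (divides 0ℤ (ℤP.+-inverseʳ a))

  ≋-reflexive : ∀ {a b} → a ≡ b → a ≋ b
  ≋-reflexive refl = ≋-refl

  ≋-sym : ∀ {a b} → a ≋ b → b ≋ a
  ≋-sym {a} {b} (∣⇒≋ n∣a-b) = ∣⇒≋ (subst (+ n ∣_) (neg-minus a b) (∣m⇒∣-m n∣a-b))
    where
    neg-minus : ∀ a b → - (a - b) ≡ b - a
    neg-minus = solve-∀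

  ≋-trans : ∀ {a b c} → a ≋ b → b ≋ c → a ≋ c
  ≋-trans {a} {b} {c} (∣⇒≋ n∣a-b) (∣⇒≋ n∣b-c) =
    ∣⇒≋ (subst (+ n ∣_) (ℤP.+-minus-telescope a b c) (∣m∣n⇒∣m+n n∣a-b n∣b-c))

  ≋-+ : ∀ {a b c d} → a ≋ b → c ≋ d → a + c ≋ b + d
  ≋-+ {a} {b} {c} {d} (∣⇒≋ n∣a-b) (∣⇒≋ n∣c-d) =
    ∣⇒≋ (subst (+ n ∣_) (minus-interchange a b c d) (∣m∣n⇒∣m+n n∣a-b n∣c-d))
    where
    minus-interchange : ∀ a b c d → (a - b) + (c - d) ≡ (a + c) - (b + d)
    minus-interchange = solve-∀

  ≋-* : ∀ {a b c d} → a ≋ b → c ≋ d → a * c ≋ b * d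
  ≋-* {a} {b} {c} {d} (∣⇒≋ n∣a-b) (∣⇒≋ n∣c-d) =
    ∣⇒≋ (subst (+ n ∣_) (product-difference a b c d) (∣m∣n⇒∣m+n (∣m⇒∣m*n c n∣a-b) (∣n⇒∣m*n b n∣c-d)))
    where
    product-difference : ∀ a b c d → (a - b) * c + b * (c - d) ≡ a * c - b * d
    product-difference = solve-∀

  n≋0 : + n ≋ 0ℤ
  n≋0 = ∣⇒≋ (subst (+ n ∣_) (sym (ℤP.+-identityʳ (+ n))) ∣-refl)

  ≋⇒diff≋0 : ∀ {a b} → a ≋ b → a - b ≋ 0ℤ
  ≋⇒diff≋0 {a} {b} (∣⇒≋ n∣a-b) = ∣⇒≋ (subst (+ n ∣_) (sym (ℤP.+-identityʳ (a - b))) n∣a-b)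

  diff≋0⇒≋ : ∀ {a b} → a - b ≋ 0ℤ → a ≋ b
  diff≋0⇒≋ {a} {b} (∣⇒≋ n∣a-b-0) = ∣⇒≋ (subst (+ n ∣_) (ℤP.+-identityʳ (a - b)) n∣a-b-0)

  sum≋0⇒≋neg : ∀ {a b} → a + b ≋ 0ℤ → a ≋ - b
  sum≋0⇒≋neg {a} {b} a+b≋0 = diff≋0⇒≋ (subst (λ c → a + c ≋ 0ℤ) (sym (ℤP.neg-involutive b)) a+b≋0)

  %ℕ-≋ : ∀ a → + (a %ℕ n) ≋ a
  %ℕ-≋ a = ≋-sym (∣⇒≋ (divides (a /ℕ n) (begin
    a - + (a %ℕ n)                               ≡⟨ cong (_- + (a %ℕ n)) (ℤD.a≡a%ℕn+[a/ℕn]*n a n) ⟩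
    (+ (a %ℕ n) + (a /ℕ n) * + n) - + (a %ℕ n)   ≡⟨ add-sub-cancel (+ (a %ℕ n)) _ ⟩
    (a /ℕ n) * + n                               ∎)))
    where
    open ≡-Reasoning
    add-sub-cancel : ∀ r q → (r + q) - r ≡ q
    add-sub-cancel = solve-∀

  ≋⇒≡ : ∀ {x y} → x < n → y < n → + x ≋ + y → x ≡ y
  ≋⇒≡ {x} {y} x<n y<n (∣⇒≋ n∣x-y) =
    ℤP.+-injective (ℤP.i-j≡0⇒i≡j (+ x) (+ y)
      (trans (ℤP.[+m]-[+n]≡m⊖n x y) (ℤP.∣i∣≡0⇒i≡0 (trans (sym (ℕD.m<n⇒m%n≡m ∣x⊖y∣<n)) (ℕ∣.n∣m⇒m%n≡0 _ n n∣∣x⊖y∣)))))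
    where
    n∣∣x⊖y∣ : n ℕ∣.∣ ∣ x ℤ.⊖ y ∣
    n∣∣x⊖y∣ = subst (λ z → n ℕ∣.∣ ∣ z ∣) (ℤP.[+m]-[+n]≡m⊖n x y) (∣⇒∣ᵤ n∣x-y)
    ∣x⊖y∣<n : ∣ x ℤ.⊖ y ∣ < n
    ∣x⊖y∣<n = ℕP.≤-<-trans (ℤP.∣m⊝n∣≤m⊔n x y) (ℕP.⊔-lub x<n y<n)

  ≋0⇒≡0 : ∀ {x} → x < n → + x ≋ 0ℤ → x ≡ 0
  ≋0⇒≡0 x<n = ≋⇒≡ x<n (ℕ.>-nonZero⁻¹ n)

  %ℕ-≡ : ∀ a {x} → x < n → a ≋ + x → a %ℕ n ≡ x
  %ℕ-≡ a x<n a≋x = ≋⇒≡ (ℤD.n%ℕd<d a n) x<n (≋-trans (%ℕ-≋ a) a≋x)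

  %ℕ-cong : ∀ {a b} → a ≋ b → a %ℕ n ≡ b %ℕ n
  %ℕ-cong {a} {b} a≋b = %ℕ-≡ a (ℤD.n%ℕd<d b n) (≋-trans a≋b (≋-sym (%ℕ-≋ b)))

  %ℕ≡⇒≋ : ∀ a b → a %ℕ n ≡ b %ℕ n → a ≋ b
  %ℕ≡⇒≋ a b a%n≡b%n = ≋-trans (≋-sym (%ℕ-≋ a)) (subst (λ r → + r ≋ b) (sym a%n≡b%n) (%ℕ-≋ b))

  ∸≋neg : ∀ x → x ≤ n → + (n ℕ.∸ x) ≋ - + x
  ∸≋neg x x≤n = ≋-trans (≋-reflexive (trans (sym (ℤP.⊖-≥ x≤n)) (sym (ℤP.[+m]-[+n]≡m⊖n n x))))
                   (≋-trans (≋-+ n≋0 (≋-refl { - + x})) (≋-reflexive (ℤP.+-identityˡ (- + x))))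

  module _ (prime : Prime n) where

    *≋0⇒≋0⊎≋0 : ∀ a b → a * b ≋ 0ℤ → a ≋ 0ℤ ⊎ b ≋ 0ℤ
    *≋0⇒≋0⊎≋0 a b (∣⇒≋ n∣ab-0) = map ∣⇒≋0 ∣⇒≋0 (euclidsLemma ∣ a ∣ ∣ b ∣ prime n∣∣a∣∣b∣)
      where
      n∣∣a∣∣b∣ : n ℕ∣.∣ ∣ a ∣ ℕ.* ∣ b ∣
      n∣∣a∣∣b∣ = subst (n ℕ∣.∣_) (trans (cong ∣_∣ (ℤP.+-identityʳ (a * b))) (ℤP.abs-* a b)) (∣⇒∣ᵤ n∣ab-0)
      ∣⇒≋0 : ∀ {c} → n ℕ∣.∣ ∣ c ∣ → c ≋ 0ℤ
      ∣⇒≋0 {c} n∣c = ∣⇒≋ (subst (+ n ∣_) (sym (ℤP.+-identityʳ c)) (∣ᵤ⇒∣ n∣c))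

    square≋⇒≋± : ∀ a b → a * a ≋ b * b → a ≋ b ⊎ a ≋ - b
    square≋⇒≋± a b a²≋b² = map diff≋0⇒≋ sum≋0⇒≋neg (*≋0⇒≋0⊎≋0 (a - b) (a + b)
      (≋-trans (≋-reflexive (difference-of-squares a b)) (≋⇒diff≋0 a²≋b²)))
      where
      difference-of-squares : ∀ a b → (a - b) * (a + b) ≡ a * a - b * b
      difference-of-squares = solve-∀

module BoundedSearch where

  open import Data.Bool using (Bool; true; false; if_then_else_)
  open import Data.Nat using (ℕ; zero; suc; _<_; z<s; s<s)
  open import Data.Product using (_×_; _,_)
  open import Function using (_∘_)
  open import Relation.Binary.PropositionalEquality

  least : ℕ → (ℕ → Bool) → ℕ
  least zero    P = zero
  least (suc n) P = if P 0 then 0 else suc (least n (P ∘ suc))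

  least-satisfies : ∀ n P {y} → y < n → P y ≡ true → least n P < n × P (least n P) ≡ true
  least-satisfies (suc n) P y<n Py with P 0 in P0
  least-satisfies (suc n) P y<n Py | true = z<s , P0
  least-satisfies (suc n) P {zero} y<n Py | false with () ← trans (sym P0) Py
  least-satisfies (suc n) P {suc y} (s<s y<n) Py | false
    with least<n , found ← least-satisfies n (P ∘ suc) y<n Py = s<s least<n , found

module QuadraticResidue (p : ℕ) .{{_ : NonZero p}} (prime : Prime p) (2<p : 2 < p) where

  open import Defs using (legendre; χ₄)
  open import Data.Bool using (Bool; true; false; _∧_; not; if_then_else_)
  open import Data.Bool.ListAction using (any)
  open import Data.Bool.Properties using (T-≡; ⇔→≡)
  open import Data.Empty using (⊥-elim)
  open import Data.List using (upTo)
  open import Data.List.Membership.Propositional using (find; lose)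
  open import Data.List.Membership.Propositional.Properties using (∈-upTo⁺; ∈-upTo⁻)
  open import Data.List.Relation.Unary.Any.Properties using (any⁺; any⁻)
  open import Data.Nat as ℕ using (ℕ; zero; suc; _≡ᵇ_; z≤n; s≤s; z<s; s<s)
  import Data.Nat.Properties as ℕP
  import Data.Nat.DivMod as ℕD
  open import Data.Integer as ℤ using (ℤ; +_; _+_; _*_; -_; _-_; 0ℤ; 1ℤ; -1ℤ; _%ℕ_; _≤_)
  import Data.Integer.Properties as ℤP
  import Data.Integer.DivMod as ℤD
  open import Data.Integer.Divisibility.Signed using (divides)
  open import Data.Integer.Tactic.RingSolver using (solve-∀)
  open import Data.Product using (∃; _×_; _,_; proj₁; proj₂)
  open import Data.Sum using (_⊎_; inj₁; inj₂; [_,_]′; map)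
  open import Function using (_∘_; _⇔_; mk⇔; Equivalence)
  open import Relation.Nullary using (¬_)
  open import Relation.Binary.PropositionalEquality
  open FiniteSum
  open BoundedSearch
  open Congruence p

  1<p : 1 < p
  1<p = ℕP.<-trans (s<s z<s) 2<p

  1<p∸1 : 1 < p ℕ.∸ 1
  1<p∸1 = ℕP.∸-monoˡ-< 2<p (s≤s z≤n)

  p∸1<p : p ℕ.∸ 1 < p
  p∸1<p = ℕP.∸-monoʳ-< z<s (ℕP.<⇒≤ 1<p)

  p∸1≢0 : p ℕ.∸ 1 ≢ 0
  p∸1≢0 p∸1≡0 = ℕP.<⇒≢ (ℕP.<-trans z<s 1<p∸1) (sym p∸1≡0)

  1≢p∸1 : 1 ≢ p ℕ.∸ 1
  1≢p∸1 = ℕP.<⇒≢ 1<p∸1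

  p∸1≋-1 : + (p ℕ.∸ 1) ≋ -1ℤ
  p∸1≋-1 = ∸≋neg 1 (ℕP.<⇒≤ 1<p)

  1≢0 : ¬ 1ℤ ≋ 0ℤ
  1≢0 = ℕP.1+n≢0 ∘ ≋0⇒≡0 1<p

  -- 2 ≢ 0 as p is odd
  ≋neg⇒≡0 : ∀ {x} → x < p → + x ≋ - + x → x ≡ 0
  ≋neg⇒≡0 {x} x<p x≋-x =
    [ ⊥-elim ∘ ℕP.1+n≢0 ∘ ≋0⇒≡0 2<p , ≋0⇒≡0 x<p ]′ (*≋0⇒≋0⊎≋0 prime (+ 2) (+ x) 2x≋0)
    where
    double : ∀ y → + 2 * y ≡ y + y
    double = solve-∀
    2x≋0 : + 2 * + x ≋ 0ℤ
    2x≋0 = ≋-trans (≋-reflexive (double (+ x)))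
             (≋-trans (≋-+ x≋-x ≋-refl) (≋-reflexive (ℤP.+-inverseˡ (+ x))))

  isSquareRoot : ℕ → ℕ → Bool
  isSquareRoot y r = (y ℕ.* y) ℕ.% p ≡ᵇ r

  isSquare : ℕ → Bool
  isSquare r = any (λ y → isSquareRoot y r) (upTo p)

  legendreᵣ : ℕ → ℤ
  legendreᵣ r = if r ≡ᵇ 0 then 0ℤ else (if isSquare r then 1ℤ else -1ℤ)

  legendre≡legendreᵣ : ∀ a → legendre a p ≡ legendreᵣ (a %ℕ p)
  legendre≡legendreᵣ a = refl

  isSquareRoot⇔ : ∀ y r → r < p → isSquareRoot y r ≡ true ⇔ + y * + y ≋ + r
  isSquareRoot⇔ y r r<p = mk⇔
    (λ root → subst (λ s → + y * + y ≋ + s) (≡ᵇ≡true⇒≡ _ r root) y²≋y²%p)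
    (λ y²≋r → ≡⇒≡ᵇ≡true _ r (%ℕ-≡ (+ (y ℕ.* y)) r<p (subst (_≋ + r) (sym (ℤP.pos-* y y)) y²≋r)))
    where
    y²≋y²%p : + y * + y ≋ + ((y ℕ.* y) ℕ.% p)
    y²≋y²%p = subst (_≋ + ((y ℕ.* y) ℕ.% p)) (ℤP.pos-* y y) (≋-sym (%ℕ-≋ (+ (y ℕ.* y))))

  isSquare-intro : ∀ {y r} → y < p → isSquareRoot y r ≡ true → isSquare r ≡ true
  isSquare-intro {y} {r} y<p root = Equivalence.to T-≡
    (any⁺ (λ z → isSquareRoot z r) (lose (∈-upTo⁺ y<p) (Equivalence.from T-≡ root)))

  isSquare-elim : ∀ {r} → isSquare r ≡ true → ∃ λ y → y < p × isSquareRoot y r ≡ true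
  isSquare-elim {r} square
    with y , y∈ , root ← find (any⁻ (λ z → isSquareRoot z r) (upTo p) (Equivalence.from T-≡ square))
    = y , ∈-upTo⁻ y∈ , Equivalence.to T-≡ root

  isSquare-1 : isSquare 1 ≡ true
  isSquare-1 = isSquare-intro 1<p (≡⇒≡ᵇ≡true _ 1 (ℕD.m<n⇒m%n≡m 1<p))

  legendreᵣ-1 : legendreᵣ 1 ≡ 1ℤ
  legendreᵣ-1 rewrite isSquare-1 = refl

  #roots : ℕ → ℤ
  #roots r = ∑ p (λ y → 𝟙 (isSquareRoot y r))

  #roots-0 : #roots 0 ≡ 1ℤ
  #roots-0 = trans (∑-cong p (λ y y<p → cong 𝟙 (≡ᵇ-cong _ 0 y 0 (mk⇔ (only-0 y y<p) 0²≡0))))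
                   (∑-𝟙≡ᵇ p 0 (ℕ.>-nonZero⁻¹ p))
    where
    only-0 : ∀ y → y < p → (y ℕ.* y) ℕ.% p ≡ 0 → y ≡ 0
    only-0 y y<p y²≡0 = [ ≋0⇒≡0 y<p , ≋0⇒≡0 y<p ]′ (*≋0⇒≋0⊎≋0 prime (+ y) (+ y)
      (Equivalence.to (isSquareRoot⇔ y 0 (ℕ.>-nonZero⁻¹ p)) (≡⇒≡ᵇ≡true _ 0 y²≡0)))
    0²≡0 : ∀ {y} → y ≡ 0 → (y ℕ.* y) ℕ.% p ≡ 0
    0²≡0 refl = ℕD.m<n⇒m%n≡m (ℕ.>-nonZero⁻¹ p)

  #roots-nonsquare : ∀ {r} → isSquare r ≡ false → #roots r ≡ 0ℤ
  #roots-nonsquare {r} nonsquare = ∑-zero p _ no-root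
    where
    no-root : ∀ y → y < p → 𝟙 (isSquareRoot y r) ≡ 0ℤ
    no-root y y<p with isSquareRoot y r in root
    ... | false = refl
    ... | true with () ← trans (sym (isSquare-intro y<p root)) nonsquare

  #roots-square : ∀ {r y₀} → r < p → r ≢ 0 → y₀ < p → isSquareRoot y₀ r ≡ true → #roots r ≡ + 2
  #roots-square {r} {y₀} r<p r≢0 y₀<p root₀ =
    trans (∑-cong p (λ y y<p → 𝟙-two-points y₀≢y₁ (roots y y<p)))
          (trans (∑-distrib-+ p _ _) (cong₂ _+_ (∑-𝟙≡ᵇ p y₀ y₀<p) (∑-𝟙≡ᵇ p y₁ y₁<p)))
    where
    y₁ = p ℕ.∸ y₀
    y₀²≋r : + y₀ * + y₀ ≋ + r
    y₀²≋r = Equivalence.to (isSquareRoot⇔ y₀ r r<p) root₀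
    y₀≢0 : y₀ ≢ 0
    y₀≢0 refl = r≢0 (≋0⇒≡0 r<p (≋-sym y₀²≋r))
    y₁<p : y₁ < p
    y₁<p = ℕP.∸-monoʳ-< (ℕP.n≢0⇒n>0 y₀≢0) (ℕP.<⇒≤ y₀<p)
    y₁≋-y₀ : + y₁ ≋ - + y₀
    y₁≋-y₀ = ∸≋neg y₀ (ℕP.<⇒≤ y₀<p)
    y₀≢y₁ : y₀ ≢ y₁
    y₀≢y₁ y₀≡y₁ = y₀≢0 (≋neg⇒≡0 y₀<p (subst (λ z → + z ≋ - + y₀) (sym y₀≡y₁) y₁≋-y₀))
    neg-square : ∀ a → - a * - a ≡ a * a
    neg-square = solve-∀
    roots : ∀ y → y < p → isSquareRoot y r ≡ true ⇔ (y ≡ y₀ ⊎ y ≡ y₁)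
    roots y y<p = mk⇔
      (λ root → map (≋⇒≡ y<p y₀<p) (λ y≋-y₀ → ≋⇒≡ y<p y₁<p (≋-trans y≋-y₀ (≋-sym y₁≋-y₀)))
                     (square≋⇒≋± prime (+ y) (+ y₀)
                        (≋-trans (Equivalence.to (isSquareRoot⇔ y r r<p) root) (≋-sym y₀²≋r))))
      [ (λ y≡y₀ → subst (λ z → isSquareRoot z r ≡ true) (sym y≡y₀) root₀)
      , (λ y≡y₁ → subst (λ z → isSquareRoot z r ≡ true) (sym y≡y₁)
                    (Equivalence.from (isSquareRoot⇔ y₁ r r<p)
                       (≋-trans (≋-* y₁≋-y₀ y₁≋-y₀) (≋-trans (≋-reflexive (neg-square (+ y₀))) y₀²≋r)))) ]′

  #roots≡1+legendreᵣ : ∀ r → r < p → #roots r ≡ 1ℤ + legendreᵣ r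
  #roots≡1+legendreᵣ zero    _   = #roots-0
  #roots≡1+legendreᵣ (suc r) r<p with isSquare (suc r) in square
  ... | true  = let y₀ , y₀<p , root₀ = isSquare-elim square in #roots-square r<p (λ ()) y₀<p root₀
  ... | false = #roots-nonsquare square

  legendreᵣ≡#roots-1 : ∀ r → r < p → legendreᵣ r ≡ #roots r - 1ℤ
  legendreᵣ≡#roots-1 r r<p =
    trans (sym (add-sub-cancel 1ℤ (legendreᵣ r))) (cong (_- 1ℤ) (sym (#roots≡1+legendreᵣ r r<p)))
    where
    add-sub-cancel : ∀ a b → (a + b) - a ≡ b
    add-sub-cancel = solve-∀

  linear : ℤ → ℤ → ℕ → ℕ
  linear c d t = (c + + t * d) %ℕ p

  linear<p : ∀ c d t → linear c d t < p
  linear<p c d t = ℤD.n%ℕd<d (c + + t * d) p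

  module _ (c d : ℤ) (d≢0 : ¬ d ≋ 0ℤ) where

    linear-hits-once : ∀ r → r < p → ∑ p (λ t → 𝟙 (r ≡ᵇ linear c d t)) ≡ 1ℤ
    linear-hits-once = ∑≡n⇒≡1 p hits hits≤1 ∑hits≡p
      where
      hits : ℕ → ℤ
      hits r = ∑ p (λ t → 𝟙 (r ≡ᵇ linear c d t))
      linear-difference : ∀ c d x y → (x - y) * d ≡ (c + x * d) - (c + y * d)
      linear-difference = solve-∀
      linear-injective : ∀ s t → s < p → t < p → linear c d s ≡ linear c d t → s ≡ t
      linear-injective s t s<p t<p ls≡lt =
        [ ≋⇒≡ s<p t<p ∘ diff≋0⇒≋ , ⊥-elim ∘ d≢0 ]′ (*≋0⇒≋0⊎≋0 prime (+ s - + t) d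
          (≋-trans (≋-reflexive (linear-difference c d (+ s) (+ t)))
                   (≋⇒diff≋0 (%ℕ≡⇒≋ (c + + s * d) (c + + t * d) ls≡lt))))
      hits≤1 : ∀ r → r < p → hits r ≤ 1ℤ
      hits≤1 r _ = ∑𝟙≤1 p (λ t → r ≡ᵇ linear c d t) λ s t s<p t<p hit-s hit-t →
        linear-injective s t s<p t<p
          (trans (sym (≡ᵇ≡true⇒≡ r (linear c d s) hit-s)) (≡ᵇ≡true⇒≡ r (linear c d t) hit-t))
      ∑hits≡p : ∑ p hits ≡ + p
      ∑hits≡p = trans (∑-comm p p _)
                  (trans (∑-cong p (λ t _ → ∑-𝟙≡ᵇ p (linear c d t) (linear<p c d t))) (∑-one p))

    ∑legendreᵣ-linear : ∑ p (λ t → legendreᵣ (linear c d t)) ≡ 0ℤ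
    ∑legendreᵣ-linear = begin
      ∑ p (λ t → legendreᵣ (linear c d t))
        ≡⟨ ∑-cong p (λ t _ → legendreᵣ≡#roots-1 (linear c d t) (linear<p c d t)) ⟩
      ∑ p (λ t → #roots (linear c d t) - 1ℤ)               ≡⟨ ∑-distrib-+ p _ _ ⟩
      ∑ p (λ t → #roots (linear c d t)) + ∑ p (λ _ → -1ℤ)  ≡⟨ cong₂ _+_ ∑#roots (∑-const p -1ℤ) ⟩
      + p + + p * -1ℤ                                      ≡⟨ cancel (+ p) ⟩
      0ℤ                                                   ∎
      where
      open ≡-Reasoning
      -- after swapping the sums, each y is a square root of linear c d t for exactly one t
      ∑#roots : ∑ p (λ t → #roots (linear c d t)) ≡ + p
      ∑#roots = trans (∑-comm p p _) (trans (∑-cong p (λ y _ →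
                  linear-hits-once ((y ℕ.* y) ℕ.% p) (ℕD.m%n<n (y ℕ.* y) p))) (∑-one p))
      cancel : ∀ a → a + a * -1ℤ ≡ 0ℤ
      cancel = solve-∀

  ∑legendreᵣ≡0 : ∑ p legendreᵣ ≡ 0ℤ
  ∑legendreᵣ≡0 = trans
    (∑-cong p (λ t t<p → cong legendreᵣ (sym (%ℕ-≡ (0ℤ + + t * 1ℤ) t<p (≋-reflexive (t-as-linear (+ t)))))))
    (∑legendreᵣ-linear 0ℤ 1ℤ 1≢0)
    where
    t-as-linear : ∀ t → 0ℤ + t * 1ℤ ≡ t
    t-as-linear = solve-∀

  inverse-exists : ∀ {x} → x < p → x ≢ 0 → ∃ λ y → y < p × + x * + y ≋ 1ℤ
  inverse-exists {x} x<p x≢0 = y , y<p , xy≋1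
    where
    hit-1 : ∃ λ t → t < p × (1 ≡ᵇ linear 0ℤ (+ x) t) ≡ true
    hit-1 = ∑𝟙≡1⇒∃ p (λ t → 1 ≡ᵇ linear 0ℤ (+ x) t) (linear-hits-once 0ℤ (+ x) (x≢0 ∘ ≋0⇒≡0 x<p) 1 1<p)
    y = proj₁ hit-1
    y<p = proj₁ (proj₂ hit-1)
    1≡yx%p : 1 ≡ (0ℤ + + y * + x) %ℕ p
    1≡yx%p = ≡ᵇ≡true⇒≡ 1 (linear 0ℤ (+ x) y) (proj₂ (proj₂ hit-1))
    xy≋1 : + x * + y ≋ 1ℤ
    xy≋1 = ≋-trans (≋-reflexive (trans (ℤP.*-comm (+ x) (+ y)) (sym (ℤP.+-identityˡ (+ y * + x)))))
             (≋-trans (≋-sym (%ℕ-≋ (0ℤ + + y * + x))) (≋-reflexive (cong +_ (sym 1≡yx%p))))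

  isInverse : ℕ → ℕ → Bool
  isInverse x y = (x ℕ.* y) ℕ.% p ≡ᵇ 1

  -- extended by 0 ↦ 0 so as to be an involution of [0, p)
  inv : ℕ → ℕ
  inv zero      = zero
  inv x@(suc _) = least p (isInverse x)

  inv-spec : ∀ {x} → x < p → x ≢ 0 → inv x < p × + x * + inv x ≋ 1ℤ
  inv-spec {zero}      _   x≢0 = ⊥-elim (x≢0 refl)
  inv-spec {x@(suc _)} x<p x≢0 = proj₁ found , x*inv≋1
    where
    y = proj₁ (inverse-exists x<p x≢0)
    y<p = proj₁ (proj₂ (inverse-exists x<p x≢0))
    xy≋1 : + x * + y ≋ 1ℤ
    xy≋1 = proj₂ (proj₂ (inverse-exists x<p x≢0))
    isInverse⇐ : ∀ z → + x * + z ≋ 1ℤ → isInverse x z ≡ true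
    isInverse⇐ z xz≋1 = ≡⇒≡ᵇ≡true _ 1 (%ℕ-≡ (+ (x ℕ.* z)) 1<p (subst (_≋ 1ℤ) (sym (ℤP.pos-* x z)) xz≋1))
    found : least p (isInverse x) < p × isInverse x (least p (isInverse x)) ≡ true
    found = least-satisfies p (isInverse x) y<p (isInverse⇐ y xy≋1)
    x*inv≋1 : + x * + inv x ≋ 1ℤ
    x*inv≋1 = subst (_≋ 1ℤ) (ℤP.pos-* x (inv x))
      (≋-trans (≋-sym (%ℕ-≋ (+ (x ℕ.* inv x)))) (≋-reflexive (cong +_ (≡ᵇ≡true⇒≡ _ 1 (proj₂ found)))))

  inv-< : ∀ x → x < p → inv x < p
  inv-< zero        _   = ℕ.>-nonZero⁻¹ p
  inv-< x@(suc _)   x<p = proj₁ (inv-spec x<p λ ())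

  inv-unique : ∀ {x y} → x < p → x ≢ 0 → y < p → + x * + y ≋ 1ℤ → inv x ≡ y
  inv-unique {x} {y} x<p x≢0 y<p xy≋1 =
    [ ⊥-elim ∘ x≢0 ∘ ≋0⇒≡0 x<p , ≋⇒≡ (inv-< x x<p) y<p ∘ diff≋0⇒≋ ]′
      (*≋0⇒≋0⊎≋0 prime (+ x) (+ inv x - + y) (≋-trans (≋-reflexive (*-distribˡ-- (+ x) _ _))
        (≋⇒diff≋0 (≋-trans (proj₂ (inv-spec x<p x≢0)) (≋-sym xy≋1)))))
    where
    *-distribˡ-- : ∀ a b c → a * (b - c) ≡ a * b - a * c
    *-distribˡ-- = solve-∀

  inv≢0 : ∀ {x} → x < p → x ≢ 0 → inv x ≢ 0
  inv≢0 {x} x<p x≢0 inv≡0 = 1≢0 (≋-trans (≋-sym (proj₂ (inv-spec x<p x≢0)))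
    (≋-reflexive (trans (cong (λ z → + x * + z) inv≡0) (ℤP.*-zeroʳ (+ x)))))

  inv-involutive : ∀ x → x < p → inv (inv x) ≡ x
  inv-involutive zero        _   = refl
  inv-involutive x@(suc _)   x<p = inv-unique (inv-< x x<p) (inv≢0 x<p λ ()) x<p
    (subst (_≋ 1ℤ) (ℤP.*-comm (+ x) _) (proj₂ (inv-spec x<p λ ())))

  self-inverse⇔±1 : ∀ {x} → x < p → x ≢ 0 → inv x ≡ x ⇔ (x ≡ 1 ⊎ x ≡ p ℕ.∸ 1)
  self-inverse⇔±1 {x} x<p x≢0 = mk⇔ to from
    where
    to : inv x ≡ x → x ≡ 1 ⊎ x ≡ p ℕ.∸ 1
    to inv≡x = map (≋⇒≡ x<p 1<p) (λ x≋-1 → ≋⇒≡ x<p p∸1<p (≋-trans x≋-1 (≋-sym p∸1≋-1)))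
      (square≋⇒≋± prime (+ x) 1ℤ (subst (λ y → + x * + y ≋ 1ℤ) inv≡x (proj₂ (inv-spec x<p x≢0))))
    from : x ≡ 1 ⊎ x ≡ p ℕ.∸ 1 → inv x ≡ x
    from (inj₁ x≡1) = trans (cong inv x≡1) (trans (inv-unique 1<p (λ ()) 1<p ≋-refl) (sym x≡1))
    from (inj₂ x≡p∸1) = trans (cong inv x≡p∸1)
      (trans (inv-unique p∸1<p p∸1≢0 p∸1<p (≋-* p∸1≋-1 p∸1≋-1)) (sym x≡p∸1))

  isNonzeroSquare : ℕ → Bool
  isNonzeroSquare r = not (r ≡ᵇ 0) ∧ isSquare r

  isNonzeroSquare-≢0 : ∀ {r} → r ≢ 0 → isNonzeroSquare r ≡ isSquare r
  isNonzeroSquare-≢0 {r} r≢0 rewrite ≢⇒≡ᵇ≡false r 0 r≢0 = refl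

  isNonzeroSquare-elim : ∀ {r} → isNonzeroSquare r ≡ true → r ≢ 0 × isSquare r ≡ true
  isNonzeroSquare-elim {zero}  ()
  isNonzeroSquare-elim {suc r} square = (λ ()) , square

  #nonzeroSquares : ℤ
  #nonzeroSquares = ∑ p (𝟙 ∘ isNonzeroSquare)

  legendreᵣ≡ : ∀ r → legendreᵣ r ≡ (𝟙 (isNonzeroSquare r) + 𝟙 (isNonzeroSquare r)) - 𝟙 (not (r ≡ᵇ 0))
  legendreᵣ≡ zero = refl
  legendreᵣ≡ (suc r) with isSquare (suc r)
  ... | true  = refl
  ... | false = refl

  2#nonzeroSquares+1≡p : (#nonzeroSquares + #nonzeroSquares) + 1ℤ ≡ + p
  2#nonzeroSquares+1≡p = begin
    (Q + Q) + 1ℤ                       ≡⟨ rearrange Q (+ p) ⟩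
    ((Q + Q) - (+ p - 1ℤ)) + + p       ≡⟨ cong (_+ + p) ∑legendreᵣ≡ ⟨
    ∑ p legendreᵣ + + p                ≡⟨ cong (_+ + p) ∑legendreᵣ≡0 ⟩
    0ℤ + + p                           ≡⟨ ℤP.+-identityˡ (+ p) ⟩
    + p                                ∎
    where
    open ≡-Reasoning
    Q = #nonzeroSquares
    rearrange : ∀ q n → (q + q) + 1ℤ ≡ ((q + q) - (n - 1ℤ)) + n
    rearrange = solve-∀
    𝟙-not : ∀ b → 𝟙 (not b) ≡ 1ℤ - 𝟙 b
    𝟙-not true  = refl
    𝟙-not false = refl
    #nonzero : ∑ p (λ r → 𝟙 (not (r ≡ᵇ 0))) ≡ + p - 1ℤ
    #nonzero = trans (∑-cong p (λ r _ → 𝟙-not (r ≡ᵇ 0)))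
                 (trans (∑-distrib-+ p (λ _ → 1ℤ) (λ r → - 𝟙 (r ≡ᵇ 0)))
                   (cong₂ _+_ (∑-one p) (trans (∑-neg p _) (cong -_ (∑-𝟙≡ᵇ p 0 (ℕ.>-nonZero⁻¹ p))))))
    ∑legendreᵣ≡ : ∑ p legendreᵣ ≡ (Q + Q) - (+ p - 1ℤ)
    ∑legendreᵣ≡ = trans (∑-cong p (λ r _ → legendreᵣ≡ r))
                    (trans (∑-distrib-+ p _ _)
                      (cong₂ _+_ (∑-distrib-+ p _ _) (trans (∑-neg p _) (cong -_ #nonzero))))

  isNonzeroSquare-inv : ∀ {x} → x < p → isNonzeroSquare x ≡ true → isNonzeroSquare (inv x) ≡ true
  isNonzeroSquare-inv {x} x<p x-square =
    trans (isNonzeroSquare-≢0 (inv≢0 x<p x≢0))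
          (subst (λ z → isSquare z ≡ true) (sym inv-x≡s) (isSquare-intro (inv-< y y<p) (≡⇒≡ᵇ≡true s s refl)))
    where
    x≢0 = proj₁ (isNonzeroSquare-elim x-square)
    y-root = isSquare-elim (proj₂ (isNonzeroSquare-elim x-square))
    y = proj₁ y-root
    y<p = proj₁ (proj₂ y-root)
    y²≋x : + y * + y ≋ + x
    y²≋x = Equivalence.to (isSquareRoot⇔ y x x<p) (proj₂ (proj₂ y-root))
    y≢0 : y ≢ 0
    y≢0 y≡0 = x≢0 (≋0⇒≡0 x<p (≋-sym (subst (λ z → + z * + z ≋ + x) y≡0 y²≋x)))
    w = inv y
    s = (w ℕ.* w) ℕ.% p
    s≋w² : + s ≋ + w * + w
    s≋w² = subst (+ s ≋_) (ℤP.pos-* w w) (%ℕ-≋ (+ (w ℕ.* w)))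
    regroup : ∀ a b → (a * a) * (b * b) ≡ (a * b) * (a * b)
    regroup = solve-∀
    xs≋1 : + x * + s ≋ 1ℤ
    xs≋1 = ≋-trans (≋-* (≋-sym y²≋x) s≋w²)
             (≋-trans (≋-reflexive (regroup (+ y) (+ w)))
               (≋-* (proj₂ (inv-spec y<p y≢0)) (proj₂ (inv-spec y<p y≢0))))
    inv-x≡s : inv x ≡ s
    inv-x≡s = inv-unique x<p x≢0 (ℕD.m%n<n (w ℕ.* w) p) xs≋1

  open Involution p inv inv-< inv-involutive

  isNonzeroSquare∘inv : ∀ x → x < p → isNonzeroSquare (inv x) ≡ isNonzeroSquare x
  isNonzeroSquare∘inv x x<p = ⇔→≡ (mk⇔
    (λ inv-square → subst (λ z → isNonzeroSquare z ≡ true) (inv-involutive x x<p)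
                       (isNonzeroSquare-inv (inv-< x x<p) inv-square))
    (isNonzeroSquare-inv x<p))

  #fixed-isNonzeroSquare : #fixed isNonzeroSquare ≡ 1ℤ + 𝟙 (isSquare (p ℕ.∸ 1))
  #fixed-isNonzeroSquare = begin
    #fixed isNonzeroSquare                                        ≡⟨ ∑-cong p fixed-at ⟩
    ∑ p (λ x → 𝟙 (x ≡ᵇ 1) * q x + 𝟙 (x ≡ᵇ p ℕ.∸ 1) * q x)        ≡⟨ ∑-distrib-+ p _ _ ⟩
    ∑ p (λ x → 𝟙 (x ≡ᵇ 1) * q x) + ∑ p (λ x → 𝟙 (x ≡ᵇ p ℕ.∸ 1) * q x)
      ≡⟨ cong₂ _+_ (∑-𝟙≡ᵇ-* p 1 q 1<p) (∑-𝟙≡ᵇ-* p (p ℕ.∸ 1) q p∸1<p) ⟩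
    q 1 + q (p ℕ.∸ 1)
      ≡⟨ cong₂ (λ a b → 𝟙 a + 𝟙 b) (isNonzeroSquare-≢0 {1} (λ ())) (isNonzeroSquare-≢0 p∸1≢0) ⟩
    𝟙 (isSquare 1) + 𝟙 (isSquare (p ℕ.∸ 1))
      ≡⟨ cong (λ b → 𝟙 b + 𝟙 (isSquare (p ℕ.∸ 1))) isSquare-1 ⟩
    1ℤ + 𝟙 (isSquare (p ℕ.∸ 1))                                   ∎
    where
    open ≡-Reasoning
    q : ℕ → ℤ
    q = 𝟙 ∘ isNonzeroSquare
    fixed-at : ∀ x → x < p →
      𝟙 (isNonzeroSquare x ∧ (inv x ≡ᵇ x)) ≡ 𝟙 (x ≡ᵇ 1) * q x + 𝟙 (x ≡ᵇ p ℕ.∸ 1) * q x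
    fixed-at x x<p with isNonzeroSquare x in x-square
    ... | false = sym (cong₂ _+_ (ℤP.*-zeroʳ (𝟙 (x ≡ᵇ 1))) (ℤP.*-zeroʳ (𝟙 (x ≡ᵇ p ℕ.∸ 1))))
    ... | true  = trans
      (𝟙-two-points 1≢p∸1 (mk⇔ (to ∘ ≡ᵇ≡true⇒≡ (inv x) x) (≡⇒≡ᵇ≡true (inv x) x ∘ from)))
      (sym (cong₂ _+_ (ℤP.*-identityʳ (𝟙 (x ≡ᵇ 1))) (ℤP.*-identityʳ (𝟙 (x ≡ᵇ p ℕ.∸ 1)))))
      where open Equivalence (self-inverse⇔±1 x<p (proj₁ (isNonzeroSquare-elim x-square)))

  #nonzeroSquares≡ :
    #nonzeroSquares ≡ (#pairs isNonzeroSquare + #pairs isNonzeroSquare) + (1ℤ + 𝟙 (isSquare (p ℕ.∸ 1)))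
  #nonzeroSquares≡ = trans (∑𝟙≡2#pairs+#fixed isNonzeroSquare isNonzeroSquare∘inv)
                           (cong (_+_ (#pairs isNonzeroSquare + #pairs isNonzeroSquare)) #fixed-isNonzeroSquare)

  module Mod4 = Congruence 4

  p≋3+2𝟙[-1-square] : + p Mod4.≋ + 3 + + 2 * 𝟙 (isSquare (p ℕ.∸ 1))
  p≋3+2𝟙[-1-square] = Mod4.∣⇒≋ (divides K (begin
    + p - (+ 3 + + 2 * b)
      ≡⟨ cong (_- (+ 3 + + 2 * b)) 2#nonzeroSquares+1≡p ⟨
    ((Q + Q) + 1ℤ) - (+ 3 + + 2 * b)
      ≡⟨ cong (λ z → ((z + z) + 1ℤ) - (+ 3 + + 2 * b)) #nonzeroSquares≡ ⟩
    ((((K + K) + (1ℤ + b)) + ((K + K) + (1ℤ + b))) + 1ℤ) - (+ 3 + + 2 * b)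
      ≡⟨ collect K b ⟩
    K * + 4
      ∎))
    where
    open ≡-Reasoning
    Q = #nonzeroSquares
    K = #pairs isNonzeroSquare
    b = 𝟙 (isSquare (p ℕ.∸ 1))
    collect : ∀ k b → ((((k + k) + (1ℤ + b)) + ((k + k) + (1ℤ + b))) + 1ℤ) - (+ 3 + + 2 * b) ≡ k * + 4
    collect = solve-∀

  χ₄-resp-%4 : ∀ m n → m ℕ.% 4 ≡ n ℕ.% 4 → χ₄ m ≡ χ₄ n
  χ₄-resp-%4 m n m≡n with m ℕ.% 4 | n ℕ.% 4
  ... | r | s with refl ← m≡n = refl

  legendreᵣ-≢0 : ∀ {r} → r ≢ 0 → legendreᵣ r ≡ (if isSquare r then 1ℤ else -1ℤ)
  legendreᵣ-≢0 {r} r≢0 rewrite ≢⇒≡ᵇ≡false r 0 r≢0 = refl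

  χ₄-from-%4 : ∀ b → p ℕ.% 4 ≡ (+ 3 + + 2 * 𝟙 b) %ℕ 4 → (if b then 1ℤ else -1ℤ) ≡ χ₄ p
  χ₄-from-%4 true  p%4≡1 = sym (χ₄-resp-%4 p 1 p%4≡1)
  χ₄-from-%4 false p%4≡3 = sym (χ₄-resp-%4 p 3 p%4≡3)

  legendreᵣ[p∸1]≡χ₄ : legendreᵣ (p ℕ.∸ 1) ≡ χ₄ p
  legendreᵣ[p∸1]≡χ₄ = trans (legendreᵣ-≢0 p∸1≢0)
    (χ₄-from-%4 (isSquare (p ℕ.∸ 1)) (Mod4.%ℕ-cong p≋3+2𝟙[-1-square]))

module Cubic where

  open import Defs using (cubic)
  open import Data.Integer using (+_; _+_; _*_; _-_; 0ℤ; 1ℤ; -1ℤ)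
  import Data.Integer.Properties as ℤP
  open import Data.Integer.Tactic.RingSolver using (solve-∀)
  open import Relation.Binary.PropositionalEquality

  cubic-linear-in-t : ∀ t x → cubic t x ≡ (x * x * x - + 3 * x + 1ℤ) + t * (x * x - x)
  cubic-linear-in-t = expand
    where
    expand : ∀ t x → x * x * x + t * x * x - (t + + 3) * x + 1ℤ ≡ (x * x * x - + 3 * x + 1ℤ) + t * (x * x - x)
    expand = solve-∀

  cubic-at-0 : ∀ t → cubic t 0ℤ ≡ 1ℤ
  cubic-at-0 t = trans (cubic-linear-in-t t 0ℤ) (cong (_+_ 1ℤ) (ℤP.*-zeroʳ t))

  cubic-at-1 : ∀ t → cubic t 1ℤ ≡ -1ℤ
  cubic-at-1 t = trans (cubic-linear-in-t t 1ℤ) (cong (_+_ -1ℤ) (ℤP.*-zeroʳ t))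

module CharacterSum (p : ℕ) .{{_ : NonZero p}} (prime : Prime p) (2<p : 2 < p) where

  open import Defs using (Σ<; legendre; cubic; A; χ₄)
  open import Data.Nat as ℕ using (ℕ; _≤_; z<s)
  import Data.Nat.Properties as ℕP
  import Data.Nat.DivMod as ℕD
  open import Data.Integer as ℤ using (ℤ; +_; _+_; _*_; -_; _-_; 0ℤ; 1ℤ; -1ℤ)
  open import Data.Integer.Tactic.RingSolver using (solve-∀)
  open import Data.Sum using ([_,_]′)
  open import Function using (_∘_)
  open import Relation.Nullary using (¬_)
  open import Relation.Binary.PropositionalEquality
  open FiniteSum
  open Congruence p
  open QuadraticResidue p prime 2<p
  open Cubic

  ∑ₜ : ℕ → ℤ
  ∑ₜ x = ∑ p (λ t → legendre (cubic (+ t) (+ x)) p)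

  ∑ₜ-0 : ∑ₜ 0 ≡ + p
  ∑ₜ-0 = trans (∑-cong p (λ t _ → trans (cong (λ z → legendre z p) (cubic-at-0 (+ t))) legendre-1)) (∑-one p)
    where
    legendre-1 : legendre 1ℤ p ≡ 1ℤ
    legendre-1 = trans (legendre≡legendreᵣ 1ℤ) (trans (cong legendreᵣ (ℕD.m<n⇒m%n≡m 1<p)) legendreᵣ-1)

  ∑ₜ-1 : ∑ₜ 1 ≡ + p * χ₄ p
  ∑ₜ-1 = trans (∑-cong p (λ t _ → trans (cong (λ z → legendre z p) (cubic-at-1 (+ t))) legendre-[-1]))
               (∑-const p (χ₄ p))
    where
    legendre-[-1] : legendre -1ℤ p ≡ χ₄ p
    legendre-[-1] = trans (legendre≡legendreᵣ -1ℤ)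
      (trans (cong legendreᵣ (%ℕ-≡ -1ℤ p∸1<p (≋-sym p∸1≋-1))) legendreᵣ[p∸1]≡χ₄)

  ∑ₜ-≥2 : ∀ x → 2 ≤ x → x < p → ∑ₜ x ≡ 0ℤ
  ∑ₜ-≥2 x 2≤x x<p = begin
    ∑ₜ x                                  ≡⟨ ∑-cong p (λ t _ → cong (λ z → legendre z p) (cubic-linear-in-t (+ t) (+ x))) ⟩
    ∑ p (λ t → legendre (c + + t * d) p)  ≡⟨ ∑-cong p (λ t _ → legendre≡legendreᵣ (c + + t * d)) ⟩
    ∑ p (λ t → legendreᵣ (linear c d t))  ≡⟨ ∑legendreᵣ-linear c d d≢0 ⟩
    0ℤ                                    ∎
    where
    open ≡-Reasoning
    c d : ℤ
    c = + x * + x * + x - + 3 * + x + 1ℤ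
    d = + x * + x - + x
    factor : ∀ x → x * (x - 1ℤ) ≡ x * x - x
    factor = solve-∀
    x≢0 : x ≢ 0
    x≢0 x≡0 = ℕP.<⇒≢ (ℕP.<-trans z<s 2≤x) (sym x≡0)
    x≢1 : x ≢ 1
    x≢1 x≡1 = ℕP.<⇒≢ 2≤x (sym x≡1)
    d≢0 : ¬ d ≋ 0ℤ
    d≢0 d≋0 = [ x≢0 ∘ ≋0⇒≡0 x<p , x≢1 ∘ ≋⇒≡ x<p 1<p ∘ diff≋0⇒≋ ]′
      (*≋0⇒≋0⊎≋0 prime (+ x) (+ x - 1ℤ) (≋-trans (≋-reflexive (factor (+ x))) d≋0))

  ∑∑ₜ : ∑ p ∑ₜ ≡ + p + + p * χ₄ p
  ∑∑ₜ = trans (∑-supported-on-0-1 p ∑ₜ (ℕP.<⇒≤ 2<p) ∑ₜ-≥2) (cong₂ _+_ ∑ₜ-0 ∑ₜ-1)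

  Σ<A≡ : Σ< p (λ t → A t p) ≡ + p * - (+ 1 + χ₄ p)
  Σ<A≡ = begin
    Σ< p (λ t → A t p)                                      ≡⟨ Σ<≡∑ p _ ⟩
    ∑ p (λ t → A t p)                                       ≡⟨ ∑-cong p (λ t _ → cong -_ (Σ<≡∑ p _)) ⟩
    ∑ p (λ t → - ∑ p (λ x → legendre (cubic (+ t) (+ x)) p)) ≡⟨ ∑-neg p _ ⟩
    - ∑ p (λ t → ∑ p (λ x → legendre (cubic (+ t) (+ x)) p)) ≡⟨ cong -_ (∑-comm p p _) ⟩
    - ∑ p ∑ₜ                                                ≡⟨ cong -_ ∑∑ₜ ⟩
    - (+ p + + p * χ₄ p)                                    ≡⟨ factor (+ p) (χ₄ p) ⟩
    + p * - (+ 1 + χ₄ p)                                    ∎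
    where
    open ≡-Reasoning
    factor : ∀ n c → - (n + n * c) ≡ n * - (+ 1 + c)
    factor = solve-∀

open import Defs
open import Data.Nat using (suc)
open import Data.Integer as ℤ using (+_; _+_; _*_; -[1+_]; +[1+_])
import Data.Integer.Properties as ℤP
open import Data.Rational using (-_; _/_; mkℚ)
import Data.Rational.Properties as ℚP
import Data.Rational.Unnormalised as ℚᵘ
open import Data.Product using (_×_; _,_)
open import Relation.Binary.PropositionalEquality
open FiniteSum using (Σ<-neg)

neg-involutive : ∀ q → - (- q) ≡ q
neg-involutive (mkℚ (+ 0)     _ _) = refl
neg-involutive (mkℚ +[1+ _ ]  _ _) = refl
neg-involutive (mkℚ -[1+ _ ]  _ _) = refl

neg-/ : ∀ z n .{{_ : NonZero n}} → (ℤ.- z) / n ≡ - (z / n)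
neg-/ (+ 0)     n = trans (ℚP.0/n≡0 n) (cong -_ (sym (ℚP.0/n≡0 n)))
neg-/ +[1+ _ ]  n = refl
neg-/ -[1+ _ ]  n = sym (neg-involutive _)

n*z/n≡z/1 : ∀ n .{{_ : NonZero n}} z → (+ n * z) / n ≡ z / 1
n*z/n≡z/1 (suc n) z = ℚP.fromℚᵘ-cong {ℚᵘ.mkℚᵘ (+ suc n * z) n} {ℚᵘ.mkℚᵘ z 0}
  (ℚᵘ.*≡* (trans (ℤP.*-identityʳ _) (ℤP.*-comm (+ suc n) z)))

lemma3p2 : (p : ℕ) → .{{_ : NonZero p}} → Prime p → 2 < p →
    (sqrtp-Q-p-1 p ≡ - sqrtp-Q-1-p p)
      × (sqrtp-Q-p-1 p ≡ - ((+ 1 + χ₄ p) / 1))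
lemma3p2 p p-prime 2<p = Q[p,1]≡-Q[1,p] , Q[p,1]≡-[1+χ₄]
  where
  open ≡-Reasoning
  open CharacterSum p p-prime 2<p using (Σ<A≡)
  ΣA = Σ< p (λ t → A t p)
  Q[p,1]≡-Q[1,p] : sqrtp-Q-p-1 p ≡ - sqrtp-Q-1-p p
  Q[p,1]≡-Q[1,p] = begin
    ΣA / p                 ≡⟨ neg-involutive (ΣA / p) ⟨
    - (- (ΣA / p))         ≡⟨ cong -_ (neg-/ ΣA p) ⟨
    - ((ℤ.- ΣA) / p)       ≡⟨ cong (λ z → - (z / p)) (Σ<-neg p (λ t → A t p)) ⟨
    - sqrtp-Q-1-p p        ∎
  Q[p,1]≡-[1+χ₄] : sqrtp-Q-p-1 p ≡ - ((+ 1 + χ₄ p) / 1)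
  Q[p,1]≡-[1+χ₄] = begin
    ΣA / p                        ≡⟨ cong (λ z → z / p) Σ<A≡ ⟩
    (+ p * ℤ.- (+ 1 + χ₄ p)) / p  ≡⟨ n*z/n≡z/1 p (ℤ.- (+ 1 + χ₄ p)) ⟩
    (ℤ.- (+ 1 + χ₄ p)) / 1        ≡⟨ neg-/ (+ 1 + χ₄ p) 1 ⟩
    - ((+ 1 + χ₄ p) / 1)          ∎
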